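{- Every self-complementary split graph $G$ admits a diamond partition. If $G$ has even order, then it admits a diamond partition that is self-complementary.
   Context: Graphs are finite and simple. A graph is self-complementary if it is isomorphic to its complement $\overline G$; an isomorphism $\sigma: V(G)\to V(G)$ from $G$ to $\overline G$ is an antimorphism of $G$. A split graph is a graph whose vertex set can be partitioned into a clique and an independent set. A diamond partition of $G$ is a partition of $V(G)$ into four nonempty sets $V_1,V_2,V_3,V_4$ such that every vertex of $V_1$ is adjacent to every vertex of $V_3$ and no vertex of $V_2$ is adjacent to any vertex of $V_4$. A partition of $V(G)$ is self-complementary if it forms the same partition in the complement, i.e., there is an antimorphism $\sigma$ of $G$ that maps each part of the partition onto a part of the partition. -}

module Defs where

open import Data.Nat using (ℕ)
open import Data.Fin using (Fin)
open import Data.Bool using (Bool; true; false; not)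
open import Data.Product using (Σ; ∃; _×_)
open import Relation.Binary.PropositionalEquality using (_≡_; _≢_)
open import Function.Bundles using (_↔_; Inverse)
open import Function.Base using (_∘_)

record Graph (n : ℕ) : Set where
  field
    adj   : Fin n → Fin n → Bool
    sym   : ∀ u v → adj u v ≡ adj v u
    irref : ∀ v → adj v v ≡ false
open Graph public

IsAntimorphism : ∀ {n} → Graph n → (Fin n ↔ Fin n) → Set
IsAntimorphism {n} G σ =
  ∀ (u v : Fin n) → u ≢ v → adj G (Inverse.to σ u) (Inverse.to σ v) ≡ not (adj G u v)

SelfComplementary : ∀ {n} → Graph n → Set
SelfComplementary {n} G = Σ (Fin n ↔ Fin n) (IsAntimorphism G)

-- Split graph: V partitions into a clique K (vertices with K v ≡ true)
-- and an independent set (vertices with K v ≡ false); either part may be empty.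
IsSplit : ∀ {n} → Graph n → Set
IsSplit {n} G = Σ (Fin n → Bool) λ K →
  (∀ u v → u ≢ v → K u ≡ true → K v ≡ true → adj G u v ≡ true) ×
  (∀ u v → K u ≡ false → K v ≡ false → adj G u v ≡ false)

-- A partition of V into four labelled parts V₁..V₄ is a labelling
-- p : Fin n → Fin 4 (label i ↦ part V_{i+1}); all parts nonempty.
AllPartsNonempty : ∀ {n} → (Fin n → Fin 4) → Set
AllPartsNonempty {n} p = ∀ (i : Fin 4) → ∃ λ (v : Fin n) → p v ≡ i

-- Diamond partition: V₁ complete to V₃, V₂ anticomplete to V₄.
-- (labels: V₁ = 0, V₂ = 1, V₃ = 2, V₄ = 3)
IsDiamondPartition : ∀ {n} → Graph n → (Fin n → Fin 4) → Set
IsDiamondPartition {n} G p =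
  AllPartsNonempty p ×
  (∀ u v → p u ≡ Fin.zero → p v ≡ Fin.suc (Fin.suc Fin.zero) → adj G u v ≡ true) ×
  (∀ u v → p u ≡ Fin.suc Fin.zero → p v ≡ Fin.suc (Fin.suc (Fin.suc Fin.zero)) → adj G u v ≡ false)
  where import Data.Fin as Fin

-- Self-complementary partition: some antimorphism σ of G maps each part onto a part,
-- i.e. there is a permutation π of the four labels with p (σ v) ≡ π (p v) for all v.
IsSelfComplementaryPartition : ∀ {n} → Graph n → (Fin n → Fin 4) → Set
IsSelfComplementaryPartition {n} G p =
  Σ (Fin n ↔ Fin n) λ σ → IsAntimorphism G σ ×
  Σ (Fin 4 ↔ Fin 4) λ π → ∀ (v : Fin n) → p (Inverse.to σ v) ≡ Inverse.to π (p v)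

module Submission where

open import Defs
open import Data.Nat using (ℕ; _≤_)
open import Data.Nat.Divisibility using (_∣_)
open import Data.Fin using (Fin)
open import Data.Product using (Σ; _×_)

open import Data.Bool using (Bool; true; false; not; _∧_; if_then_else_)
open import Data.Bool.Properties using (not-involutive)
import Data.Bool.Properties as Bool
open import Data.Empty using (⊥; ⊥-elim)
open import Data.Fin using (zero; suc; toℕ; fromℕ<; punchIn; punchOut)
open import Data.Fin.Patterns using (0F; 1F; 2F; 3F)
open import Data.Fin.Properties
  using (_≟_; any?; all?; pigeonhole; suc-injective; toℕ<n; toℕ-fromℕ<; toℕ-injective;
         punchInᵢ≢i; punchIn-injective; punchIn-punchOut; punchOut-injective)
open import Data.Nat using (zero; suc; _+_; _*_; _∸_; _<_; z≤n; s≤s; s≤s⁻¹)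
open import Data.Nat.DivMod using (_%_; _/_; m≡m%n+[m/n]*n; m%n<n)
open import Data.Nat.Divisibility using (divides; ∣⇒≤; ∣m+n∣m⇒∣n)
open import Data.Nat.GeneralisedArithmetic using (iterate)
import Data.Nat.Properties as ℕ
open import Data.Nat.Tactic.RingSolver using (solve-∀)
open import Algebra.Properties.CommutativeMonoid.Sum ℕ.+-0-commutativeMonoid
  using (sum; sum-permute; sum-cong-≗; ∑-distrib-+)
open import Data.Product using (∃; _,_; proj₁; proj₂)
open import Data.Sum using (_⊎_; inj₁; inj₂)
open import Function.Base using (_∘_)
open import Function.Bundles using (_↔_; Inverse; Injection; mk↔ₛ′)
open import Function.Properties.Inverse using (↔⇒↣)
open import Relation.Binary.PropositionalEquality as ≡
  using (_≡_; _≢_; refl; trans; cong; cong₂; subst; _≗_; module ≡-Reasoning)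
open import Relation.Nullary using (¬_; Dec; yes; no; does)
open import Relation.Nullary.Decidable using (¬?; _×-dec_; _→-dec_; map′; dec-true; dec-false)

-- Fix an antimorphism σ and a split partition into a clique K and an independent set I.
-- There are no self-complementary graphs on 2 or 3 vertices. On n ≥ 4 vertices K and I both have
-- at least two vertices, since σ cannot map a graph whose only edges (or non-edges) meet one vertex
-- to its complement; then {k₁}, {i₁}, K - k₁, I - i₁ is a diamond partition.
-- For even n, σ swaps K and I. At most one vertex of K stays in K under σ and at most one vertex
-- of I stays in I; counting gives 2|K| + #(I stays) = n + #(K stays), so both numbers have the
-- same parity, and if both are 1 then moving σ of the clique keeper (or, in the complement, of the
-- independent keeper) to the other side yields a split partition violating the count. Hence every
-- cycle of σ alternates between K and I, and its length is divisible by 4: were it 2m with m odd,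
-- σᵐ would map the pair {v, σᵐ v} to itself while flipping its adjacency. Labelling each vertex
-- by its position modulo 4 along its cycle gives a diamond partition whose parts σ permutes
-- cyclically.

iterate-+ : ∀ {A : Set} (f : A → A) x m n → iterate f x (m + n) ≡ iterate f (iterate f x m) n
iterate-+ f x zero    n = refl
iterate-+ f x (suc m) n = iterate-+ f (f x) m n

iterate-natural : ∀ {A B : Set} {f : A → A} {g : B → B} (h : A → B) →
  (∀ x → h (f x) ≡ g (h x)) → ∀ x k → h (iterate f x k) ≡ iterate g (h x) k
iterate-natural h comm x zero    = refl
iterate-natural {g = g} h comm x (suc k) =
  trans (iterate-natural h comm _ k) (cong (λ y → iterate g y k) (comm x))

iterate-injective : ∀ {A : Set} {f : A → A} → (∀ {x y} → f x ≡ f y → x ≡ y) →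
  ∀ k {x y} → iterate f x k ≡ iterate f y k → x ≡ y
iterate-injective inj zero    eq = eq
iterate-injective inj (suc k) eq = inj (iterate-injective inj k eq)

iterate-not-involutive : ∀ k b → iterate not (iterate not b k) k ≡ b
iterate-not-involutive zero    b = refl
iterate-not-involutive (suc k) b = begin
  iterate not (iterate not (not b) k) (suc k)   ≡⟨ cong (λ c → iterate not (not c) k) (≡.sym (iterate-natural not (λ _ → refl) b k)) ⟩
  iterate not (not (not (iterate not b k))) k   ≡⟨ cong (λ c → iterate not c k) (not-involutive _) ⟩
  iterate not (iterate not b k) k               ≡⟨ iterate-not-involutive k b ⟩
  b                                             ∎
  where open ≡-Reasoning

iterate-not-fixed⇒even : ∀ k {b} → iterate not b k ≡ b → 2 ∣ k
iterate-not-fixed⇒even zero          _  = divides 0 refl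
iterate-not-fixed⇒even (suc zero) {b} eq = ⊥-elim (Bool.not-¬ refl (≡.sym eq))
iterate-not-fixed⇒even (suc (suc k)) {b} eq
  with divides q k≡q*2 ← iterate-not-fixed⇒even k (trans (cong (λ c → iterate not c k) (≡.sym (not-involutive b))) eq)
  = divides (suc q) (cong (λ m → suc (suc m)) k≡q*2)

double : ∀ m → m + m ≡ m * 2
double m = trans (cong (m +_) (≡.sym (ℕ.*-identityʳ m))) (≡.sym (ℕ.*-suc m 1))

2∤odd : ∀ {m} → 2 ∣ m → ¬ 2 ∣ m + 1
2∤odd 2∣m 2∣m+1 with s≤s () ← ∣⇒≤ (∣m+n∣m⇒∣n 2∣m+1 2∣m)

indicator : Bool → ℕ
indicator b = if b then 1 else 0

count : ∀ {n} → (Fin n → Bool) → ℕ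
count f = sum (indicator ∘ f)

count-+-pointwise : ∀ {n} {f g h k : Fin n → Bool} →
  (∀ v → indicator (f v) + indicator (g v) ≡ indicator (h v) + indicator (k v)) →
  count f + count g ≡ count h + count k
count-+-pointwise {f = f} {g} {h} {k} eq = begin
  count f + count g                           ≡⟨ ∑-distrib-+ (indicator ∘ f) (indicator ∘ g) ⟨
  sum (λ v → indicator (f v) + indicator (g v)) ≡⟨ sum-cong-≗ eq ⟩
  sum (λ v → indicator (h v) + indicator (k v)) ≡⟨ ∑-distrib-+ (indicator ∘ h) (indicator ∘ k) ⟩
  count h + count k                           ∎
  where open ≡-Reasoning

count-cong : ∀ {n} {f g : Fin n → Bool} → f ≗ g → count f ≡ count g
count-cong eq = sum-cong-≗ (cong indicator ∘ eq)

count-permute : ∀ {n} (f : Fin n → Bool) (σ : Fin n ↔ Fin n) → count (f ∘ Inverse.to σ) ≡ count f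
count-permute f σ = ≡.sym (sum-permute (indicator ∘ f) σ)

count-none : ∀ {n} (f : Fin n → Bool) → (∀ v → f v ≡ false) → count f ≡ 0
count-none {zero}  f none = refl
count-none {suc n} f none rewrite none zero = count-none (f ∘ suc) (none ∘ suc)

count-all : ∀ n → count (λ (_ : Fin n) → true) ≡ n
count-all zero    = refl
count-all (suc n) = cong suc (count-all n)

count-not : ∀ {n} (f : Fin n → Bool) → count (not ∘ f) + count f ≡ n
count-not {n} f = begin
  count (not ∘ f) + count f                                 ≡⟨ count-+-pointwise (indicator-not ∘ f) ⟩
  count (λ (_ : Fin n) → true) + count (λ (_ : Fin n) → false) ≡⟨ cong₂ _+_ (count-all n) (count-none {n} _ (λ _ → refl)) ⟩
  n + 0                                                     ≡⟨ ℕ.+-identityʳ n ⟩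
  n                                                         ∎
  where
    open ≡-Reasoning
    indicator-not : ∀ b → indicator (not b) + indicator b ≡ 1 + 0
    indicator-not true  = refl
    indicator-not false = refl

count-≥1 : ∀ {n} (f : Fin n → Bool) {v} → f v ≡ true → 1 ≤ count f
count-≥1 f {zero}  fv rewrite fv = s≤s z≤n
count-≥1 f {suc v} fv = ℕ.≤-trans (count-≥1 (f ∘ suc) fv) (ℕ.m≤n+m _ (indicator (f zero)))

count-≤1 : ∀ {n} (f : Fin n → Bool) → (∀ {u v} → f u ≡ true → f v ≡ true → u ≡ v) → count f ≤ 1
count-≤1 {zero}  f unique = z≤n
count-≤1 {suc n} f unique with f zero in f0
... | true  = s≤s (ℕ.≤-reflexive (count-none (f ∘ suc) only-zero))
  where only-zero : ∀ v → f (suc v) ≡ false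
        only-zero v with f (suc v) in fv
        ... | true  with () ← unique f0 fv
        ... | false = refl
... | false = count-≤1 (f ∘ suc) (λ fu fv → suc-injective (unique fu fv))

count-remove : ∀ {n} (f : Fin n → Bool) {t} → f t ≡ true →
  count f ≡ suc (count (λ v → f v ∧ not (does (v ≟ t))))
count-remove {suc n} f {zero} ft rewrite ft =
  cong suc (count-cong (λ v → ≡.sym (Bool.∧-identityʳ (f (suc v)))))
count-remove {suc n} f {suc t} ft rewrite Bool.∧-identityʳ (f zero) =
  trans (cong (indicator (f zero) +_) (count-remove (f ∘ suc) ft)) (ℕ.+-suc _ _)

count-≡1 : ∀ {n} (f : Fin n → Bool) → (∀ {u v} → f u ≡ true → f v ≡ true → u ≡ v) →
  ∀ {v} → f v ≡ true → count f ≡ 1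
count-≡1 f unique fv = ℕ.≤-antisym (count-≤1 f unique) (count-≥1 f fv)

alternating⇒even : ∀ {n} (σ : Fin n ↔ Fin n) (f : Fin n → Bool) →
  (∀ v → f (Inverse.to σ v) ≡ not (f v)) → 2 ∣ n
alternating⇒even {n} σ f alternating = divides (count f) (begin
  n                         ≡⟨ count-not f ⟨
  count (not ∘ f) + count f ≡⟨ cong (_+ count f) (trans (count-cong (≡.sym ∘ alternating)) (count-permute f σ)) ⟩
  count f + count f         ≡⟨ double (count f) ⟩
  count f * 2               ∎)
  where open ≡-Reasoning

next prev : Fin 4 → Fin 4
next 0F = 1F
next 1F = 2F
next 2F = 3F
next 3F = 0F
prev 0F = 3F
prev 1F = 0F
prev 2F = 1F
prev 3F = 2F

next-prev : ∀ x → next (prev x) ≡ x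
next-prev 0F = refl
next-prev 1F = refl
next-prev 2F = refl
next-prev 3F = refl

prev-next : ∀ x → prev (next x) ≡ x
prev-next 0F = refl
prev-next 1F = refl
prev-next 2F = refl
prev-next 3F = refl

evenLabel : Fin 4 → Bool
evenLabel 0F = true
evenLabel 1F = false
evenLabel 2F = true
evenLabel 3F = false

evenLabel-prev : ∀ x → evenLabel (prev x) ≡ not (evenLabel x)
evenLabel-prev 0F = refl
evenLabel-prev 1F = refl
evenLabel-prev 2F = refl
evenLabel-prev 3F = refl

prev-multiple-of-4 : ∀ {k} → 4 ∣ k → ∀ x → iterate prev x k ≡ x
prev-multiple-of-4 (divides q refl) = prev-times-4 q
  where
    prev-times-4 : ∀ q x → iterate prev x (q * 4) ≡ x
    prev-times-4 zero    x  = refl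
    prev-times-4 (suc q) 0F = prev-times-4 q 0F
    prev-times-4 (suc q) 1F = prev-times-4 q 1F
    prev-times-4 (suc q) 2F = prev-times-4 q 2F
    prev-times-4 (suc q) 3F = prev-times-4 q 3F

next-reaches : ∀ x y → ∃ λ k → iterate next x k ≡ y
next-reaches x y = 4 ∸ toℕ x + toℕ y , (begin
  iterate next x (4 ∸ toℕ x + toℕ y)            ≡⟨ iterate-+ next x (4 ∸ toℕ x) (toℕ y) ⟩
  iterate next (iterate next x (4 ∸ toℕ x)) (toℕ y) ≡⟨ cong (λ z → iterate next z (toℕ y)) (to-0F x) ⟩
  iterate next 0F (toℕ y)                        ≡⟨ from-0F y ⟩
  y                                              ∎)
  where
    open ≡-Reasoning
    to-0F : ∀ x → iterate next x (4 ∸ toℕ x) ≡ 0F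
    to-0F 0F = refl
    to-0F 1F = refl
    to-0F 2F = refl
    to-0F 3F = refl
    from-0F : ∀ y → iterate next 0F (toℕ y) ≡ y
    from-0F 0F = refl
    from-0F 1F = refl
    from-0F 2F = refl
    from-0F 3F = refl

-- Cycles of a permutation

Least : (ℕ → Set) → ℕ → Set
Least P k = P k × (∀ {j} → j < k → ¬ P j)

least : ∀ {P : ℕ → Set} → (∀ k → Dec (P k)) → ∀ {m} → P m → ∃ (Least P)
least P? {zero}  p₀ = 0 , p₀ , λ ()
least P? {suc m} pₘ with P? 0
... | yes p₀ = 0 , p₀ , λ ()
... | no ¬p₀ with k , pₖ , below ← least (P? ∘ suc) pₘ =
  suc k , pₖ , λ { {zero} _ → ¬p₀ ; {suc j} (s≤s j<k) → below j<k }

least-unique : ∀ {P : ℕ → Set} {j k} → Least P j → Least P k → j ≡ k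
least-unique (pⱼ , belowⱼ) (pₖ , belowₖ) =
  ℕ.≤-antisym (ℕ.≮⇒≥ (λ k<j → belowⱼ k<j pₖ)) (ℕ.≮⇒≥ (λ j<k → belowₖ j<k pⱼ))

module Cycles {n} (σ : Fin n ↔ Fin n) where
  open Inverse σ using (to)

  σ^ : ℕ → Fin n → Fin n
  σ^ k v = iterate to v k

  σ^-multiple : ∀ {R v} → σ^ R v ≡ v → ∀ q → σ^ (q * R) v ≡ v
  σ^-multiple         ret zero    = refl
  σ^-multiple {R} {v} ret (suc q) = trans (iterate-+ to v R (q * R))
    (trans (cong (λ w → σ^ (q * R) w) ret) (σ^-multiple ret q))

  σ^-mod : ∀ {L v} → σ^ (suc L) v ≡ v → ∀ k → σ^ (k % suc L) v ≡ σ^ k v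
  σ^-mod {L} {v} ret k = ≡.sym (begin
    σ^ k v                           ≡⟨ cong (λ i → σ^ i v) (trans (m≡m%n+[m/n]*n k R) (ℕ.+-comm (k % R) _)) ⟩
    σ^ ((k / R) * R + k % R) v       ≡⟨ iterate-+ to v ((k / R) * R) (k % R) ⟩
    σ^ (k % R) (σ^ ((k / R) * R) v)  ≡⟨ cong (σ^ (k % R)) (σ^-multiple ret (k / R)) ⟩
    σ^ (k % R) v                     ∎)
    where open ≡-Reasoning
          R = suc L

  returns : ∀ v → ∃ λ L → L < n × σ^ (suc L) v ≡ v
  returns v with i , j , i<j , σⁱv≡σʲv ← pigeonhole (ℕ.n<1+n n) (λ (i : Fin (suc n)) → σ^ (toℕ i) v)
           with L , i+1+L≡j ← ℕ.m≤n⇒∃[o]m+o≡n i<j =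
    L , L<n , ≡.sym (iterate-injective (Injection.injective (↔⇒↣ σ)) (toℕ i) (begin
      σ^ (toℕ i) v                 ≡⟨ σⁱv≡σʲv ⟩
      σ^ (toℕ j) v                 ≡⟨ cong (λ k → σ^ k v) j≡L+1+i ⟩
      σ^ (suc L + toℕ i) v         ≡⟨ iterate-+ to v (suc L) (toℕ i) ⟩
      σ^ (toℕ i) (σ^ (suc L) v)    ∎))
    where
      open ≡-Reasoning
      j≡L+1+i : toℕ j ≡ suc L + toℕ i
      j≡L+1+i = trans (≡.sym i+1+L≡j) (cong suc (ℕ.+-comm (toℕ i) L))
      L<n : L < n
      L<n = ℕ.≤-trans (ℕ.m≤m+n (suc L) (toℕ i))
              (ℕ.≤-trans (ℕ.≤-reflexive (≡.sym j≡L+1+i)) (s≤s⁻¹ (toℕ<n j)))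

  _⇝_ : Fin n → Fin n → Set
  v ⇝ w = ∃ λ k → σ^ k v ≡ w

  ⇝-trans : ∀ {u v w} → u ⇝ v → v ⇝ w → u ⇝ w
  ⇝-trans {u} (j , refl) (k , refl) = j + k , iterate-+ to u j k

  ⇝-sym : ∀ {v w} → v ⇝ w → w ⇝ v
  ⇝-sym {v} (j , refl) with L , _ , ret ← returns v = j * L , (begin
    σ^ (j * L) (σ^ j v)   ≡⟨ iterate-+ to v j (j * L) ⟨
    σ^ (j + j * L) v      ≡⟨ cong (λ k → σ^ k v) (ℕ.*-suc j L) ⟨
    σ^ (j * suc L) v      ≡⟨ σ^-multiple ret j ⟩
    v                     ∎)
    where open ≡-Reasoning

  ⇝-bounded : ∀ {v w} → v ⇝ w → ∃ λ (j : Fin n) → σ^ (toℕ j) v ≡ w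
  ⇝-bounded {v} (k , refl) with L , L<n , ret ← returns v =
    fromℕ< r<n , trans (cong (λ i → σ^ i v) (toℕ-fromℕ< r<n)) (σ^-mod ret k)
    where r<n = ℕ.<-≤-trans (m%n<n k (suc L)) L<n

  _⇝?_ : ∀ v w → Dec (v ⇝ w)
  v ⇝? w = map′ (λ (j , e) → toℕ j , e) ⇝-bounded (any? (λ j → σ^ (toℕ j) v ≟ w))

  IsOrbitMinimum : Fin n → Set
  IsOrbitMinimum w = ∀ u → w ⇝ u → toℕ w ≤ toℕ u

  isOrbitMinimum? : ∀ w → Dec (IsOrbitMinimum w)
  isOrbitMinimum? w = all? (λ u → (w ⇝? u) →-dec (toℕ w ℕ.≤? toℕ u))

  orbit-minima-coincide : ∀ {v w} → IsOrbitMinimum v → IsOrbitMinimum w → v ⇝ w → v ≡ w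
  orbit-minima-coincide {v} {w} min-v min-w v⇝w =
    toℕ-injective (ℕ.≤-antisym (min-v w v⇝w) (min-w v (⇝-sym v⇝w)))

  orbit-minimum : ∀ v → ∃ λ k → IsOrbitMinimum (σ^ k v)
  orbit-minimum v
    with m , (u , (k , refl) , u≡m) , below ← least {P = λ m → ∃ λ u → v ⇝ u × toℕ u ≡ m}
                                               (λ m → any? (λ u → (v ⇝? u) ×-dec (toℕ u ℕ.≟ m)))
                                               (v , (0 , refl) , refl)
    = k , λ u′ σᵏv⇝u′ → subst (_≤ toℕ u′) (≡.sym u≡m)
            (ℕ.≮⇒≥ (λ u′<m → below u′<m (u′ , ⇝-trans (k , refl) σᵏv⇝u′ , refl)))

  distance-to-minimum : ∀ v → ∃ (Least (λ k → IsOrbitMinimum (σ^ k v)))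
  distance-to-minimum v with k , min ← orbit-minimum v = least (λ k → isOrbitMinimum? (σ^ k v)) {k} min

  dist : Fin n → ℕ
  dist v = proj₁ (distance-to-minimum v)

  dist-least : ∀ v → Least (λ k → IsOrbitMinimum (σ^ k v)) (dist v)
  dist-least v = proj₂ (distance-to-minimum v)

  dist-suc : ∀ {v k} → dist v ≡ suc k → dist (to v) ≡ k
  dist-suc {v} {k} dv≡1+k with min , below ← subst (Least _) dv≡1+k (dist-least v) =
    least-unique (dist-least (to v)) (min , λ j<k → below (s≤s j<k))

  dist-zero : ∀ {v} → dist v ≡ 0 → σ^ (suc (dist (to v))) v ≡ v
  dist-zero {v} dv≡0 = orbit-minima-coincide (proj₁ (dist-least (to v)))
    (proj₁ (subst (Least _) dv≡0 (dist-least v))) (⇝-sym (suc (dist (to v)) , refl))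

  -- v lies dist v steps before the least vertex of its cycle, and that vertex is labelled by seed.
  label : (Fin n → Fin 4) → Fin n → Fin 4
  label seed v = iterate prev (seed (σ^ (dist v) v)) (dist v)

  label-step : (∀ {k v} → σ^ k v ≡ v → 4 ∣ k) → ∀ seed v → label seed (to v) ≡ next (label seed v)
  label-step period seed v = step (dist v) refl
    where
      open ≡-Reasoning
      next-iterate-prev : ∀ x k → next (iterate prev x (suc k)) ≡ iterate prev x k
      next-iterate-prev x k = trans (cong next (≡.sym (iterate-natural prev (λ _ → refl) x k))) (next-prev _)
      label-at : ∀ {d} → dist v ≡ d → label seed v ≡ iterate prev (seed (σ^ d v)) d
      label-at = cong (λ d → iterate prev (seed (σ^ d v)) d)
      step : ∀ d → dist v ≡ d → label seed (to v) ≡ next (label seed v)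
      step (suc k) dv≡1+k = begin
        label seed (to v)                          ≡⟨ cong (λ d → iterate prev (seed (σ^ d (to v))) d) (dist-suc dv≡1+k) ⟩
        iterate prev (seed (σ^ k (to v))) k        ≡⟨ next-iterate-prev _ k ⟨
        next (iterate prev (seed (σ^ (suc k) v)) (suc k)) ≡⟨ cong next (label-at dv≡1+k) ⟨
        next (label seed v)                        ∎
      step zero dv≡0 = begin
        label seed (to v)                          ≡⟨ cong (λ w → iterate prev (seed w) d) (dist-zero {v} dv≡0) ⟩
        iterate prev (seed v) d                    ≡⟨ next-iterate-prev (seed v) d ⟨
        next (iterate prev (seed v) (suc d))       ≡⟨ cong next (prev-multiple-of-4 (period {suc d} {v} (dist-zero dv≡0)) (seed v)) ⟩
        next (seed v)                              ≡⟨ cong next (label-at dv≡0) ⟨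
        next (label seed v)                        ∎
        where d = dist (to v)

  label-parity : ∀ {K : Fin n → Bool} → (∀ v → K (to v) ≡ not (K v)) →
    ∀ {seed} → (∀ v → evenLabel (seed v) ≡ K v) → ∀ v → evenLabel (label seed v) ≡ K v
  label-parity {K} alternating {seed} seed-parity v = begin
    evenLabel (iterate prev (seed (σ^ d v)) d)         ≡⟨ iterate-natural evenLabel evenLabel-prev _ d ⟩
    iterate not (evenLabel (seed (σ^ d v))) d          ≡⟨ cong (λ b → iterate not b d) (seed-parity _) ⟩
    iterate not (K (σ^ d v)) d                         ≡⟨ cong (λ b → iterate not b d) (iterate-natural K alternating v d) ⟩
    iterate not (iterate not (K v) d) d                ≡⟨ iterate-not-involutive d (K v) ⟩
    K v                                                ∎
    where open ≡-Reasoning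
          d = dist v

to-≢ : ∀ {n} (σ : Fin n ↔ Fin n) {u v} → u ≢ v → Inverse.to σ u ≢ Inverse.to σ v
to-≢ σ u≢v = u≢v ∘ Injection.injective (↔⇒↣ σ)

IsSplitPartition : ∀ {n} → Graph n → (Fin n → Bool) → Set
IsSplitPartition {n} G K =
  (∀ u v → u ≢ v → K u ≡ true → K v ≡ true → adj G u v ≡ true) ×
  (∀ u v → K u ≡ false → K v ≡ false → adj G u v ≡ false)

∧≡true : ∀ {x y} → x ∧ y ≡ true → x ≡ true × y ≡ true
∧≡true {true} {true} _ = refl , refl

split-remove : ∀ {n} (G : Graph n) {K} → IsSplitPartition G K →
  ∀ t → (∀ v → K v ≡ false → adj G t v ≡ false) → IsSplitPartition G (λ v → K v ∧ not (does (v ≟ t)))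
split-remove G {K} (clique , independent) t t-isolated =
  (λ u v u≢v K′u K′v → clique u v u≢v (proj₁ (∧≡true K′u)) (proj₁ (∧≡true K′v))) , independent′
  where
    removed : ∀ {v} → K v ∧ not (does (v ≟ t)) ≡ false → K v ≡ false ⊎ v ≡ t
    removed {v} K′v with K v | v ≟ t
    ... | false | _       = inj₁ refl
    ... | true  | yes v≡t = inj₂ v≡t
    independent′ : ∀ u v → K u ∧ not (does (u ≟ t)) ≡ false → K v ∧ not (does (v ≟ t)) ≡ false →
      adj G u v ≡ false
    independent′ u v K′u K′v with removed K′u | removed K′v
    ... | inj₁ Ku   | inj₁ Kv   = independent u v Ku Kv
    ... | inj₂ refl | inj₁ Kv   = t-isolated v Kv
    ... | inj₁ Ku   | inj₂ refl = trans (Graph.sym G u t) (t-isolated u Ku)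
    ... | inj₂ refl | inj₂ refl = Graph.irref G t

complement : ∀ {n} → Graph n → Graph n
complement G = record
  { adj   = λ u v → not (adj G u v) ∧ not (does (u ≟ v))
  ; sym   = λ u v → cong₂ (λ a e → not a ∧ not e) (Graph.sym G u v) (does-≟-sym u v)
  ; irref = λ v → trans (cong (λ e → not (adj G v v) ∧ not e) (dec-true (v ≟ v) refl)) (Bool.∧-zeroʳ _)
  }
  where
    does-≟-sym : ∀ {n} (u v : Fin n) → does (u ≟ v) ≡ does (v ≟ u)
    does-≟-sym u v with u ≟ v
    ... | yes u≡v = ≡.sym (dec-true (v ≟ u) (≡.sym u≡v))
    ... | no  u≢v = ≡.sym (dec-false (v ≟ u) (u≢v ∘ ≡.sym))

complement-adj : ∀ {n} (G : Graph n) {u v} → u ≢ v → adj (complement G) u v ≡ not (adj G u v)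
complement-adj G {u} {v} u≢v rewrite dec-false (u ≟ v) u≢v = Bool.∧-identityʳ _

complement-antimorphism : ∀ {n} (G : Graph n) σ → IsAntimorphism G σ → IsAntimorphism (complement G) σ
complement-antimorphism G σ anti u v u≢v = begin
  adj (complement G) (to u) (to v) ≡⟨ complement-adj G (to-≢ σ u≢v) ⟩
  not (adj G (to u) (to v))        ≡⟨ cong not (anti u v u≢v) ⟩
  not (not (adj G u v))            ≡⟨ cong not (complement-adj G u≢v) ⟨
  not (adj (complement G) u v)     ∎
  where open ≡-Reasoning; open Inverse σ using (to)

complement-split : ∀ {n} (G : Graph n) {K} → IsSplitPartition G K → IsSplitPartition (complement G) (not ∘ K)
complement-split G {K} (clique , independent) = clique′ , independent′
  where
    clique′ : ∀ u v → u ≢ v → not (K u) ≡ true → not (K v) ≡ true → adj (complement G) u v ≡ true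
    clique′ u v u≢v Ku Kv = trans (complement-adj G u≢v)
      (cong not (independent u v (Bool.not-injective Ku) (Bool.not-injective Kv)))
    independent′ : ∀ u v → not (K u) ≡ false → not (K v) ≡ false → adj (complement G) u v ≡ false
    independent′ u v Ku Kv with u ≟ v
    ... | yes refl = Bool.∧-zeroʳ _
    ... | no  u≢v  = trans (Bool.∧-identityʳ _)
      (cong not (clique u v u≢v (Bool.not-injective Ku) (Bool.not-injective Kv)))

parity-labelling⇒diamond : ∀ {n} {G : Graph n} {K} {p : Fin n → Fin 4} → IsSplitPartition G K →
  (∀ v → evenLabel (p v) ≡ K v) → AllPartsNonempty p → IsDiamondPartition G p
parity-labelling⇒diamond {G = G} {K} {p} (clique , independent) parity nonempty =
  nonempty , V₁-complete-to-V₃ , V₂-anticomplete-to-V₄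
  where
    side : ∀ {v i} → p v ≡ i → K v ≡ evenLabel i
    side {v} pv = trans (≡.sym (parity v)) (cong evenLabel pv)
    V₁-complete-to-V₃ : ∀ u v → p u ≡ 0F → p v ≡ 2F → adj G u v ≡ true
    V₁-complete-to-V₃ u v pu pv = clique u v u≢v (side pu) (side pv)
      where u≢v : u ≢ v
            u≢v refl with () ← trans (≡.sym pu) pv
    V₂-anticomplete-to-V₄ : ∀ u v → p u ≡ 1F → p v ≡ 3F → adj G u v ≡ false
    V₂-anticomplete-to-V₄ u v pu pv = independent u v (side pu) (side pv)

-- Orders 2 and 3

symmetric-on-Fin2 : (R : Fin 2 → Fin 2 → Bool) → (∀ x y → R x y ≡ R y x) →
  ∀ {x y} → x ≢ y → R x y ≡ R 0F 1F
symmetric-on-Fin2 R sym {0F} {0F} x≢y = ⊥-elim (x≢y refl)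
symmetric-on-Fin2 R sym {0F} {1F} x≢y = refl
symmetric-on-Fin2 R sym {1F} {0F} x≢y = sym 1F 0F
symmetric-on-Fin2 R sym {1F} {1F} x≢y = ⊥-elim (x≢y refl)

no-self-complementary-graph-of-order-2 : (G : Graph 2) → ¬ SelfComplementary G
no-self-complementary-graph-of-order-2 G (σ , anti) = Bool.not-¬ refl (begin
  adj G 0F 1F             ≡⟨ symmetric-on-Fin2 (adj G) (Graph.sym G) (to-≢ σ (λ ())) ⟨
  adj G (to 0F) (to 1F)   ≡⟨ anti 0F 1F (λ ()) ⟩
  not (adj G 0F 1F)       ∎)
  where open ≡-Reasoning; open Inverse σ using (to)

-- On three vertices, a pair of vertices is determined by the vertex it omits.
opposite-adj : Graph 3 → Fin 3 → Bool
opposite-adj G w = adj G (punchIn w 0F) (punchIn w 1F)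

adj≡opposite-adj : (G : Graph 3) {x y w : Fin 3} → x ≢ y → w ≢ x → w ≢ y → adj G x y ≡ opposite-adj G w
adj≡opposite-adj G {x} {y} {w} x≢y w≢x w≢y = begin
  adj G x y                                            ≡⟨ cong₂ (adj G) (punchIn-punchOut w≢x) (punchIn-punchOut w≢y) ⟨
  adj G (punchIn w (punchOut w≢x)) (punchIn w (punchOut w≢y))
    ≡⟨ symmetric-on-Fin2 (λ i j → adj G (punchIn w i) (punchIn w j)) (λ i j → Graph.sym G _ _) (x≢y ∘ punchOut-injective w≢x w≢y) ⟩
  opposite-adj G w                                     ∎
  where open ≡-Reasoning

no-self-complementary-graph-of-order-3 : (G : Graph 3) → ¬ SelfComplementary G
no-self-complementary-graph-of-order-3 G (σ , anti) = 2∤3 (alternating⇒even σ (opposite-adj G) opposite-alternates)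
  where
    open Inverse σ using (to)
    2∤3 : ¬ 2 ∣ 3
    2∤3 (divides (suc (suc _)) ())
    opposite-alternates : ∀ w → opposite-adj G (to w) ≡ not (opposite-adj G w)
    opposite-alternates w = begin
      opposite-adj G (to w)                         ≡⟨ adj≡opposite-adj G (to-≢ σ 0≢1) (to-≢ σ (w≢ 0F)) (to-≢ σ (w≢ 1F)) ⟨
      adj G (to (punchIn w 0F)) (to (punchIn w 1F)) ≡⟨ anti _ _ 0≢1 ⟩
      not (opposite-adj G w)                        ∎
      where
        open ≡-Reasoning
        w≢ : ∀ i → w ≢ punchIn w i
        w≢ i = punchInᵢ≢i w i ∘ ≡.sym
        0≢1 : punchIn w 0F ≢ punchIn w 1F
        0≢1 e with () ← punchIn-injective w 0F 1F e

-- Order at least 4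

two-avoiding : ∀ {m} (w t : Fin (4 + m)) →
  ∃ λ x → ∃ λ y → x ≢ y × x ≢ w × y ≢ w × x ≢ t × y ≢ t
two-avoiding w t = pick (t ≟ c 0F) (t ≟ c 1F)
  where
    c = punchIn w
    c-distinct : ∀ {i j} → i ≢ j → c i ≢ c j
    c-distinct i≢j = i≢j ∘ punchIn-injective w _ _
    c≢w : ∀ i → c i ≢ w
    c≢w = punchInᵢ≢i w
    pick : Dec (t ≡ c 0F) → Dec (t ≡ c 1F) → ∃ λ x → ∃ λ y → x ≢ y × x ≢ w × y ≢ w × x ≢ t × y ≢ t
    pick (yes t≡c₀) _ = c 1F , c 2F , c-distinct (λ ()) , c≢w 1F , c≢w 2F ,
      (λ e → c-distinct (λ ()) (trans e t≡c₀)) , (λ e → c-distinct (λ ()) (trans e t≡c₀))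
    pick (no t≢c₀) (yes t≡c₁) = c 0F , c 2F , c-distinct (λ ()) , c≢w 0F , c≢w 2F ,
      (t≢c₀ ∘ ≡.sym) , (λ e → c-distinct (λ ()) (trans e t≡c₁))
    pick (no t≢c₀) (no t≢c₁) = c 0F , c 1F , c-distinct (λ ()) , c≢w 0F , c≢w 1F ,
      (t≢c₀ ∘ ≡.sym) , (t≢c₁ ∘ ≡.sym)

vertex-deletion-not-homogeneous : ∀ {m} (G : Graph (4 + m)) σ → IsAntimorphism G σ →
  ∀ w b → ¬ (∀ x y → x ≢ y → x ≢ w → y ≢ w → adj G x y ≡ b)
vertex-deletion-not-homogeneous G σ anti w b homogeneous = contradiction (two-avoiding w (to w))
  where
    open Inverse σ using (to; from; strictlyInverseˡ)
    from-≢ : ∀ {x y} → x ≢ to y → from x ≢ y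
    from-≢ {x} x≢σy e = x≢σy (trans (≡.sym (strictlyInverseˡ x)) (cong to e))
    contradiction : (∃ λ x → ∃ λ y → x ≢ y × x ≢ w × y ≢ w × x ≢ to w × y ≢ to w) → ⊥
    contradiction (x , y , x≢y , x≢w , y≢w , x≢σw , y≢σw) = Bool.not-¬ refl (begin
      b                         ≡⟨ homogeneous x y x≢y x≢w y≢w ⟨
      adj G x y                 ≡⟨ cong₂ (adj G) (strictlyInverseˡ x) (strictlyInverseˡ y) ⟨
      adj G (to x′) (to y′)     ≡⟨ anti x′ y′ x′≢y′ ⟩
      not (adj G x′ y′)         ≡⟨ cong not (homogeneous x′ y′ x′≢y′ (from-≢ x≢σw) (from-≢ y≢σw)) ⟩
      not b                     ∎)
      where
        open ≡-Reasoning
        x′ = from x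
        y′ = from y
        x′≢y′ : x′ ≢ y′
        x′≢y′ e = x≢y (trans (≡.sym (strictlyInverseˡ x)) (trans (cong to e) (strictlyInverseˡ y)))

two-or-all-but-one : ∀ {n} (K : Fin (suc n) → Bool) b →
  (∃ λ x → ∃ λ y → x ≢ y × K x ≡ b × K y ≡ b) ⊎ (∃ λ w → ∀ x → x ≢ w → K x ≡ not b)
two-or-all-but-one K b with any? (λ x → K x Bool.≟ b)
... | no none = inj₂ (0F , λ x _ → Bool.¬-not (none ∘ (x ,_)))
... | yes (x , Kx) with any? (λ y → ¬? (y ≟ x) ×-dec (K y Bool.≟ b))
...   | yes (y , y≢x , Ky) = inj₁ (y , x , y≢x , Ky , Kx)
...   | no  none           = inj₂ (x , λ y y≢x → Bool.¬-not (λ Ky → none (y , y≢x , Ky)))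

two-per-side⇒parity-labelling : ∀ {n} (K : Fin n → Bool) {k₁ k₂ i₁ i₂} →
  k₁ ≢ k₂ → K k₁ ≡ true → K k₂ ≡ true → i₁ ≢ i₂ → K i₁ ≡ false → K i₂ ≡ false →
  Σ (Fin n → Fin 4) λ p → (∀ v → evenLabel (p v) ≡ K v) × AllPartsNonempty p
two-per-side⇒parity-labelling {n} K {k₁} {k₂} {i₁} {i₂} k₁≢k₂ Kk₁ Kk₂ i₁≢i₂ Ki₁ Ki₂ =
  p , (λ v → evenLabel-label (K v) _) , nonempty
  where
    label : Bool → Bool → Fin 4
    label true  true  = 0F
    label false true  = 1F
    label true  false = 2F
    label false false = 3F
    evenLabel-label : ∀ b c → evenLabel (label b c) ≡ b
    evenLabel-label true  true  = refl
    evenLabel-label false true  = refl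
    evenLabel-label true  false = refl
    evenLabel-label false false = refl
    pivot : Bool → Fin n
    pivot true  = k₁
    pivot false = i₁
    p : Fin n → Fin 4
    p v = label (K v) (does (v ≟ pivot (K v)))
    p-on : ∀ {v b} → K v ≡ b → p v ≡ label b (does (v ≟ pivot b))
    p-on {v} = cong (λ b → label b (does (v ≟ pivot b)))
    nonempty : AllPartsNonempty p
    nonempty 0F = k₁ , trans (p-on Kk₁) (cong (label true) (dec-true (k₁ ≟ k₁) refl))
    nonempty 1F = i₁ , trans (p-on Ki₁) (cong (label false) (dec-true (i₁ ≟ i₁) refl))
    nonempty 2F = k₂ , trans (p-on Kk₂) (cong (label true) (dec-false (k₂ ≟ k₁) (k₁≢k₂ ∘ ≡.sym)))
    nonempty 3F = i₂ , trans (p-on Ki₂) (cong (label false) (dec-false (i₂ ≟ i₁) (i₁≢i₂ ∘ ≡.sym)))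

diamond-partition : ∀ {m} (G : Graph (4 + m)) → SelfComplementary G → IsSplit G →
  Σ (Fin (4 + m) → Fin 4) (IsDiamondPartition G)
diamond-partition G (σ , anti) (K , split@(clique , independent))
  with two-or-all-but-one K true | two-or-all-but-one K false
... | inj₂ (w , almost-none) | _ = ⊥-elim (vertex-deletion-not-homogeneous G σ anti w false
      (λ x y _ x≢w y≢w → independent x y (almost-none x x≢w) (almost-none y y≢w)))
... | inj₁ _ | inj₂ (w , almost-all) = ⊥-elim (vertex-deletion-not-homogeneous G σ anti w true
      (λ x y x≢y x≢w y≢w → clique x y x≢y (almost-all x x≢w) (almost-all y y≢w)))
... | inj₁ (k₁ , k₂ , k₁≢k₂ , Kk₁ , Kk₂) | inj₁ (i₁ , i₂ , i₁≢i₂ , Ki₁ , Ki₂)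
  with p , parity , nonempty ← two-per-side⇒parity-labelling K k₁≢k₂ Kk₁ Kk₂ i₁≢i₂ Ki₁ Ki₂
  = p , parity-labelling⇒diamond {G = G} split parity nonempty

-- Even order: σ swaps the clique and the independent set

record AntimorphicSplit (n : ℕ) : Set where
  field
    G     : Graph n
    σ     : Fin n ↔ Fin n
    anti  : IsAntimorphism G σ
    K     : Fin n → Bool
    split : IsSplitPartition G K

dual : ∀ {n} → AntimorphicSplit n → AntimorphicSplit n
dual S = record
  { G     = complement G
  ; σ     = σ
  ; anti  = complement-antimorphism G σ anti
  ; K     = not ∘ K
  ; split = complement-split G split
  }
  where open AntimorphicSplit S

module Keepers {n} (S : AntimorphicSplit n) where
  open AntimorphicSplit S
  open Inverse σ using (to)

  keepsClique keepsIndependent : Fin n → Bool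
  keepsClique      v = K v ∧ K (to v)
  keepsIndependent v = not (K v) ∧ not (K (to v))

  keepsClique-unique : ∀ {u v} → keepsClique u ≡ true → keepsClique v ≡ true → u ≡ v
  keepsClique-unique {u} {v} ku kv with u ≟ v | ∧≡true {K u} ku | ∧≡true {K v} kv
  ... | yes u≡v | _ | _ = u≡v
  ... | no  u≢v | Ku , Kσu | Kv , Kσv = ⊥-elim (Bool.not-¬ refl (begin
    true                    ≡⟨ proj₁ split (to u) (to v) (to-≢ σ u≢v) Kσu Kσv ⟨
    adj G (to u) (to v)     ≡⟨ anti u v u≢v ⟩
    not (adj G u v)         ≡⟨ cong not (proj₁ split u v u≢v Ku Kv) ⟩
    not true                ∎))
    where open ≡-Reasoning

  balance : count K + count K + count keepsIndependent ≡ n + count keepsClique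
  balance = begin
    count K + count K + count keepsIndependent     ≡⟨ ℕ.+-assoc (count K) _ _ ⟩
    count K + (count K + count keepsIndependent)   ≡⟨ cong (count K +_) (count-+-pointwise pointwise) ⟩
    count K + (count K′ + count keepsClique)       ≡⟨ ℕ.+-assoc (count K) _ _ ⟨
    count K + count K′ + count keepsClique         ≡⟨ cong (_+ count keepsClique) (ℕ.+-comm (count K) _) ⟩
    count K′ + count K + count keepsClique         ≡⟨ cong (λ m → count K′ + m + count keepsClique) (count-permute K σ) ⟨
    count K′ + count (K ∘ to) + count keepsClique  ≡⟨ cong (_+ count keepsClique) (count-not (K ∘ to)) ⟩
    n + count keepsClique                          ∎
    where
      open ≡-Reasoning
      K′ = not ∘ K ∘ to
      pointwise : ∀ v → indicator (K v) + indicator (keepsIndependent v) ≡ indicator (K′ v) + indicator (keepsClique v)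
      pointwise v with K v | K (to v)
      ... | true  | true  = refl
      ... | true  | false = refl
      ... | false | true  = refl
      ... | false | false = refl

open Keepers

keepsIndependent-unique : ∀ {n} (S : AntimorphicSplit n) {u v} →
  keepsIndependent S u ≡ true → keepsIndependent S v ≡ true → u ≡ v
keepsIndependent-unique S = keepsClique-unique (dual S)

keepsIndependent-dual : ∀ {n} (S : AntimorphicSplit n) v → keepsIndependent (dual S) v ≡ keepsClique S v
keepsIndependent-dual S v = cong₂ _∧_ (not-involutive (K v)) (not-involutive (K (Inverse.to σ v)))
  where open AntimorphicSplit S

keeper-image-isolated : ∀ {n} (S : AntimorphicSplit n) → let open AntimorphicSplit S; open Inverse σ using (to) in
  ∀ {a b} → keepsClique S a ≡ true → keepsIndependent S b ≡ true → adj G (to a) (to b) ≡ false →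
  ∀ v → K v ≡ false → adj G (to a) v ≡ false
keeper-image-isolated S {a} {b} ka ib σa≁σb v Kv with v ≟ to b | K (from v) in Ku
  where open AntimorphicSplit S; open Inverse σ using (to; from)
... | yes refl | _     = σa≁σb
... | no  v≢σb | true  = begin
  adj G (to a) v               ≡⟨ cong (adj G (to a)) (strictlyInverseˡ v) ⟨
  adj G (to a) (to (from v))   ≡⟨ anti a (from v) a≢u ⟩
  not (adj G a (from v))       ≡⟨ cong not (proj₁ split a (from v) a≢u (proj₁ (∧≡true ka)) Ku) ⟩
  false                        ∎
  where
    open AntimorphicSplit S
    open Inverse σ using (to; from; strictlyInverseˡ)
    open ≡-Reasoning
    a≢u : a ≢ from v
    a≢u a≡u = Bool.not-¬ refl (trans (≡.sym (proj₂ (∧≡true ka)))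
      (trans (cong (K ∘ to) a≡u) (trans (cong K (strictlyInverseˡ v)) Kv)))
... | no  v≢σb | false = ⊥-elim (v≢σb (trans (≡.sym (strictlyInverseˡ v)) (cong to (keepsIndependent-unique S u-keeps ib))))
  where
    open AntimorphicSplit S
    open Inverse σ using (to; from; strictlyInverseˡ)
    u-keeps : keepsIndependent S (from v) ≡ true
    u-keeps rewrite Ku | strictlyInverseˡ v | Kv = refl

removal-count : ∀ c f e n → suc c + suc c ≡ n → c + c + f ≡ n + e → f ≡ 2 + e
removal-count c f e n c+c≡n balance = ℕ.+-cancelˡ-≡ (c + c) f (2 + e) (begin
  c + c + f               ≡⟨ balance ⟩
  n + e                   ≡⟨ cong (_+ e) c+c≡n ⟨
  suc c + suc c + e       ≡⟨ shuffle c e ⟩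
  c + c + (2 + e)         ∎)
  where
    open ≡-Reasoning
    shuffle : ∀ c e → suc c + suc c + e ≡ c + c + (2 + e)
    shuffle = solve-∀

-- Moving σ a from the clique to the independent set gives a split partition that violates balance.
no-keepers-with-nonedge : ∀ {n} (S : AntimorphicSplit n) → let open AntimorphicSplit S; open Inverse σ using (to) in
  ∀ {a b} → keepsClique S a ≡ true → keepsIndependent S b ≡ true → adj G (to a) (to b) ≡ false → ⊥
no-keepers-with-nonedge {n} S {a} {b} ka ib σa≁σb =
  two≰one (subst (_≤ 1) keepers′-count (count-≤1 _ (keepsIndependent-unique S′)))
  where
    open AntimorphicSplit S
    open Inverse σ using (to)
    open ≡-Reasoning
    S′ : AntimorphicSplit n
    S′ = record S { K = λ v → K v ∧ not (does (v ≟ to a))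
                  ; split = split-remove G split (to a) (keeper-image-isolated S ka ib σa≁σb) }
    K-halves : count K + count K ≡ n
    K-halves = ℕ.+-cancelʳ-≡ 1 _ _ (begin
      count K + count K + 1                         ≡⟨ cong (count K + count K +_) (count-≡1 _ (keepsIndependent-unique S) ib) ⟨
      count K + count K + count (keepsIndependent S) ≡⟨ balance S ⟩
      n + count (keepsClique S)                     ≡⟨ cong (n +_) (count-≡1 _ (keepsClique-unique S) ka) ⟩
      n + 1                                         ∎)
    keepers′-count : count (keepsIndependent S′) ≡ 2 + count (keepsClique S′)
    keepers′-count = removal-count (count (AntimorphicSplit.K S′)) _ _ n
      (trans (cong (λ c → c + c) (≡.sym (count-remove K (proj₂ (∧≡true ka))))) K-halves) (balance S′)
    two≰one : ∀ {e} → 2 + e ≤ 1 → ⊥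
    two≰one (s≤s ())

keepers-on-one-side : ∀ {n} (S : AntimorphicSplit n) {a b} → keepsClique S a ≡ true → keepsIndependent S b ≡ true → ⊥
keepers-on-one-side S {a} {b} ka ib with adj G (to a) (to b) in σa≁σb
  where open AntimorphicSplit S; open Inverse σ using (to)
... | false = no-keepers-with-nonedge S ka ib σa≁σb
... | true  = no-keepers-with-nonedge (dual S) ib (trans (keepsIndependent-dual S a) ka)
                (trans (complement-adj G σb≢σa) (cong not (trans (Graph.sym G _ _) σa≁σb)))
  where
    open AntimorphicSplit S
    open Inverse σ using (to)
    σb≢σa : to b ≢ to a
    σb≢σa e = Bool.not-¬ refl (trans (≡.sym (proj₂ (∧≡true {K a} ka)))
                (trans (cong K (≡.sym e)) (Bool.not-injective (proj₂ (∧≡true {not (K b)} ib)))))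

keepers-balance : ∀ {n} (S : AntimorphicSplit n) → 2 ∣ n →
  ∀ {a} → keepsClique S a ≡ true → ∃ λ b → keepsIndependent S b ≡ true
keepers-balance {n} S 2∣n {a} ka with any? (λ b → keepsIndependent S b Bool.≟ true)
... | yes found = found
... | no  none  = ⊥-elim (2∤odd 2∣n (subst (2 ∣_) count-parity (divides (count K) (double (count K)))))
  where
    open AntimorphicSplit S
    open ≡-Reasoning
    count-parity : count K + count K ≡ n + 1
    count-parity = begin
      count K + count K                              ≡⟨ ℕ.+-identityʳ _ ⟨
      count K + count K + 0                          ≡⟨ cong (count K + count K +_) (count-none _ (λ b → Bool.¬-not (none ∘ (b ,_)))) ⟨
      count K + count K + count (keepsIndependent S) ≡⟨ balance S ⟩
      n + count (keepsClique S)                      ≡⟨ cong (n +_) (count-≡1 _ (keepsClique-unique S) ka) ⟩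
      n + 1                                          ∎

split-alternates : ∀ {n} (S : AntimorphicSplit n) → 2 ∣ n → let open AntimorphicSplit S in
  ∀ v → K (Inverse.to σ v) ≡ not (K v)
split-alternates S 2∣n v with K v in Kv | K (Inverse.to σ v) in Kσv
  where open AntimorphicSplit S
... | true  | false = refl
... | false | true  = refl
... | true  | true  with b , ib ← keepers-balance S 2∣n (cong₂ _∧_ Kv Kσv)
  = ⊥-elim (keepers-on-one-side S (cong₂ _∧_ Kv Kσv) ib)
... | false | false with b , kb ← keepers-balance (dual S) 2∣n (cong₂ _∧_ (cong not Kv) (cong not Kσv))
  = ⊥-elim (keepers-on-one-side S (trans (≡.sym (keepsIndependent-dual S b)) kb) (cong₂ _∧_ (cong not Kv) (cong not Kσv)))

-- Even order: cycles of σ have length divisible by 4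

module _ {n} (G : Graph n) (σ : Fin n ↔ Fin n) (anti : IsAntimorphism G σ) where
  open Inverse σ using (to)
  open Cycles σ using (σ^)

  adj-iterate : ∀ k {u v} → u ≢ v → adj G (σ^ k u) (σ^ k v) ≡ iterate not (adj G u v) k
  adj-iterate zero    u≢v = refl
  adj-iterate (suc k) {u} {v} u≢v =
    trans (adj-iterate k (to-≢ σ u≢v)) (cong (λ b → iterate not b k) (anti u v u≢v))

  module _ {K : Fin n → Bool} (alternating : ∀ v → K (to v) ≡ not (K v)) where

    return-time-even : ∀ {k v} → σ^ k v ≡ v → 2 ∣ k
    return-time-even {k} {v} σᵏv≡v =
      iterate-not-fixed⇒even k (trans (≡.sym (iterate-natural K alternating v k)) (cong K σᵏv≡v))

    half-return-time-even : ∀ {m v} → σ^ (m + m) v ≡ v → 2 ∣ m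
    half-return-time-even {m} {v} σ²ᵐv≡v with σ^ m v ≟ v
    ... | yes σᵐv≡v = return-time-even σᵐv≡v
    ... | no  σᵐv≢v = iterate-not-fixed⇒even m (begin
      iterate not (adj G v w) m  ≡⟨ adj-iterate m (σᵐv≢v ∘ ≡.sym) ⟨
      adj G w (σ^ m w)           ≡⟨ cong (adj G w) (trans (≡.sym (iterate-+ to v m m)) σ²ᵐv≡v) ⟩
      adj G w v                  ≡⟨ Graph.sym G w v ⟩
      adj G v w                  ∎)
      where open ≡-Reasoning
            w = σ^ m v

    return-time-divisible-by-4 : ∀ {k v} → σ^ k v ≡ v → 4 ∣ k
    return-time-divisible-by-4 {k} {v} σᵏv≡v
      with divides m k≡m*2 ← return-time-even σᵏv≡v
      with divides j m≡j*2 ← half-return-time-even {m}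
                               (subst (λ i → σ^ i v ≡ v) (trans k≡m*2 (≡.sym (double m))) σᵏv≡v)
      = divides j (trans k≡m*2 (trans (cong (_* 2) m≡j*2) (ℕ.*-assoc j 2 2)))

self-complementary-diamond-partition : ∀ {m} (G : Graph (suc m)) → 2 ∣ suc m → SelfComplementary G → IsSplit G →
  Σ (Fin (suc m) → Fin 4) λ p → IsDiamondPartition G p × IsSelfComplementaryPartition G p
self-complementary-diamond-partition G 2∣n (σ , anti) (K , split) =
  p , parity-labelling⇒diamond {G = G} split parity nonempty , σ , anti , mk↔ₛ′ next prev next-prev prev-next , step
  where
    open Cycles σ
    alternating : ∀ v → K (Inverse.to σ v) ≡ not (K v)
    alternating = split-alternates (record { G = G ; σ = σ ; anti = anti ; K = K ; split = split }) 2∣n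
    seed : Fin _ → Fin 4
    seed v = if K v then 0F else 1F
    p = label seed
    step : ∀ v → p (Inverse.to σ v) ≡ next (p v)
    step = label-step (return-time-divisible-by-4 G σ anti alternating) seed
    parity : ∀ v → evenLabel (p v) ≡ K v
    parity = label-parity alternating seed-parity
      where seed-parity : ∀ v → evenLabel (seed v) ≡ K v
            seed-parity v with K v
            ... | true  = refl
            ... | false = refl
    nonempty : AllPartsNonempty p
    nonempty i with k , nextᵏ≡i ← next-reaches (p 0F) i =
      σ^ k 0F , trans (iterate-natural p step 0F k) nextᵏ≡i

lemma8 : ∀ {n : ℕ} (G : Graph n) → 2 ≤ n → SelfComplementary G → IsSplit G →
    Σ (Fin n → Fin 4) (IsDiamondPartition G) ×
    (2 ∣ n → Σ (Fin n → Fin 4) λ p → IsDiamondPartition G p × IsSelfComplementaryPartition G p)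
lemma8 {1} G (s≤s ()) _ _
lemma8 {2} G _ sc _ = ⊥-elim (no-self-complementary-graph-of-order-2 G sc)
lemma8 {3} G _ sc _ = ⊥-elim (no-self-complementary-graph-of-order-3 G sc)
lemma8 {suc (suc (suc (suc m)))} G _ sc split =
  diamond-partition G sc split , λ 2∣n → self-complementary-diamond-partition G 2∣n sc split
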